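{- For every infinite $U\subseteq\mathbb Z$, the ring $LIP(U)$ is an integral domain, and its only units are the constant functions $1$ and $-1$.
   Context: For an infinite $U\subseteq\mathbb Z$, a function $f\colon U\to\mathbb Z$ is LIP on $U$ if for every finite $X\subseteq U$ there is $p\in\mathbb Z[x]$ with $p(x)=f(x)$ for all $x\in X$; $LIP(U)$ is the ring of all such functions under pointwise addition and multiplication. -}

module Defs where

open import Level using (0ℓ)
open import Data.Integer using (ℤ; _+_; _*_; 0ℤ; 1ℤ; -1ℤ)
open import Data.List using (List; []; _∷_)
open import Data.List.Membership.Propositional using (_∈_)
open import Data.Product using (Σ; _×_; _,_; proj₁)
open import Data.Sum using (_⊎_)
open import Relation.Unary using (Pred)
open import Relation.Binary.PropositionalEquality using (_≡_)
open import Relation.Nullary using (¬_)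

Subset : Set₁
Subset = Pred ℤ 0ℓ

-- Integer polynomials as coefficient lists, constant term first.
Poly : Set
Poly = List ℤ

eval : Poly → ℤ → ℤ
eval []       x = 0ℤ
eval (c ∷ cs) x = c + x * eval cs x

Finite : Subset → Set
Finite U = Σ (List ℤ) λ l → ∀ x → U x → x ∈ l

Infinite : Subset → Set
Infinite U = ¬ Finite U

El : Subset → Set
El U = Σ ℤ U

Fun : Subset → Set
Fun U = El U → ℤ

IsLIP : (U : Subset) → Fun U → Set
IsLIP U f = (X : List (El U)) →
  Σ Poly λ p → ∀ y → y ∈ X → eval p (proj₁ y) ≡ f y

_≈_ : {U : Subset} → Fun U → Fun U → Set
f ≈ g = ∀ y → f y ≡ g y

_·_ : {U : Subset} → Fun U → Fun U → Fun U
(f · g) y = f y * g y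

const : {U : Subset} → ℤ → Fun U
const c _ = c

zeroF oneF minusOneF : {U : Subset} → Fun U
zeroF = const 0ℤ
oneF = const 1ℤ
minusOneF = const -1ℤ

IsUnit : (U : Subset) → Fun U → Set
IsUnit U f = Σ (Fun U) λ g → IsLIP U g × ((f · g) ≈ oneF)

IsIntegralDomainLIP : Subset → Set
IsIntegralDomainLIP U =
  (¬ (oneF {U} ≈ zeroF)) ×
  (∀ (f g : Fun U) → IsLIP U f → IsLIP U g →
     (f · g) ≈ zeroF → (f ≈ zeroF) ⊎ (g ≈ zeroF))

UnitsArePlusMinusOne : Subset → Set
UnitsArePlusMinusOne U =
  ∀ (f : Fun U) → IsLIP U f →
    (IsUnit U f → (f ≈ oneF) ⊎ (f ≈ minusOneF)) ×
    ((f ≈ oneF) ⊎ (f ≈ minusOneF) → IsUnit U f)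

-- A LIP function f is interpolated on {x, a} by an integer polynomial, so
-- x − a divides f x − f a; hence f x ≡ f a as soon as |x − a| > |f x − f a|.
-- Classically an infinite U contains points arbitrarily far from any two given
-- points. Taking such a point x shows that a LIP function which is nonzero at a
-- is nonzero at x, which rules out zero divisors, and that a bounded LIP function
-- is constant; units take values ±1, so they are the constants 1 and -1.
module Submission where

open import Defs
open import Level using (0ℓ)
open import Axiom.ExcludedMiddle using (ExcludedMiddle)
open import Data.Empty using (⊥-elim)
open import Data.Integer using (ℤ; _+_; _*_; _-_; -_; 0ℤ; 1ℤ; -1ℤ; +_; -[1+_]; ∣_∣)
open import Data.Integer.Divisibility.Signed using (_∣_; divides; ∣-refl; ∣⇒∣ᵤ; ∣m∣n⇒∣m+n; ∣m⇒∣m*n; ∣n⇒∣m*n)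
import Data.Integer.Properties as ℤ
open import Data.Integer.Solver using (module +-*-Solver)
open import Data.List using (List; []; _∷_)
open import Data.List.Membership.Propositional using (_∈_)
open import Data.List.Relation.Unary.Any using (here; there)
open import Data.Nat as ℕ using (ℕ; zero; suc; ≢-nonZero)
import Data.Nat.Divisibility as ℕ
import Data.Nat.Properties as ℕ
open import Data.Product using (Σ; _×_; _,_; proj₁)
open import Data.Sum using (_⊎_; inj₁; inj₂; [_,_]′; map)
open import Function using (_∘_)
open import Relation.Binary.PropositionalEquality
open import Relation.Nullary using (¬_; yes; no)
open import Relation.Nullary.Decidable using (decidable-stable)

open +-*-Solver

eval-sub-divisible : ∀ p x a → (x - a) ∣ (eval p x - eval p a)
eval-sub-divisible []       x a = divides 0ℤ refl
eval-sub-divisible (c ∷ cs) x a =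
  subst ((x - a) ∣_) (sym (expand c x a (eval cs x) (eval cs a)))
    (∣m∣n⇒∣m+n (∣m⇒∣m*n (eval cs x) ∣-refl)
               (∣n⇒∣m*n a (eval-sub-divisible cs x a)))
  where
  expand : ∀ c x a px pa → (c + x * px) - (c + a * pa) ≡ (x - a) * px + a * (px - pa)
  expand = solve 5 (λ c x a px pa → (c :+ x :* px) :- (c :+ a :* pa)
                                    := (x :- a) :* px :+ a :* (px :- pa)) refl

∣⇒∣∣≤∣∣ : ∀ {i j} → i ∣ j → j ≢ 0ℤ → ∣ i ∣ ℕ.≤ ∣ j ∣
∣⇒∣∣≤∣∣ i∣j j≢0 = ℕ.∣⇒≤ {{≢-nonZero (j≢0 ∘ ℤ.∣i∣≡0⇒i≡0)}} (∣⇒∣ᵤ i∣j)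

module _ {U : Subset} {f : Fun U} (f-lip : IsLIP U f) where

  LIP-sub-divisible : (x a : El U) → (proj₁ x - proj₁ a) ∣ (f x - f a)
  LIP-sub-divisible x a with f-lip (x ∷ a ∷ [])
  ... | p , agrees = subst ((proj₁ x - proj₁ a) ∣_)
    (cong₂ _-_ (agrees x (here refl)) (agrees a (there (here refl))))
    (eval-sub-divisible p (proj₁ x) (proj₁ a))

  LIP-rigid : (x a : El U) → ∣ f x - f a ∣ ℕ.< ∣ proj₁ x - proj₁ a ∣ → f x ≡ f a
  LIP-rigid x a close = decidable-stable (f x ℤ.≟ f a) λ fx≢fa →
    ℕ.<⇒≱ close (∣⇒∣∣≤∣∣ (LIP-sub-divisible x a) (fx≢fa ∘ ℤ.i-j≡0⇒i≡j (f x) (f a)))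

  LIP-nonvanishing : (x a : El U) → f a ≢ 0ℤ → ∣ f a ∣ ℕ.< ∣ proj₁ x - proj₁ a ∣ → f x ≢ 0ℤ
  LIP-nonvanishing x a fa≢0 far fx≡0 = fa≢0 (trans (sym fx≡fa) fx≡0)
    where
    ∣fx-fa∣≡∣fa∣ : ∣ f x - f a ∣ ≡ ∣ f a ∣
    ∣fx-fa∣≡∣fa∣ = begin
      ∣ f x - f a ∣ ≡⟨ cong (λ t → ∣ t - f a ∣) fx≡0 ⟩
      ∣ 0ℤ - f a ∣  ≡⟨ cong ∣_∣ (ℤ.+-identityˡ (- f a)) ⟩
      ∣ - f a ∣     ≡⟨ ℤ.∣-i∣≡∣i∣ (f a) ⟩
      ∣ f a ∣       ∎
      where open ≡-Reasoning
    fx≡fa : f x ≡ f a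
    fx≡fa = LIP-rigid x a (subst (ℕ._< _) (sym ∣fx-fa∣≡∣fa∣) far)

ball : ℕ → List ℤ
ball zero    = 0ℤ ∷ []
ball (suc m) = + suc m ∷ -[1+ m ] ∷ ball m

∈-ball : ∀ m x → ∣ x ∣ ℕ.≤ m → x ∈ ball m
∈-ball zero    (+ zero) _ = here refl
∈-ball (suc m) x ∣x∣≤1+m with ℕ.m≤n⇒m<n∨m≡n ∣x∣≤1+m
... | inj₁ ∣x∣<1+m             = there (there (∈-ball m x (ℕ.≤-pred ∣x∣<1+m)))
∈-ball (suc m) (+ n)    _ | inj₂ n≡1+m = here (cong +_ n≡1+m)
∈-ball (suc m) -[1+ n ] _ | inj₂ refl  = there (here refl)

∣a∣+K<∣x∣⇒K<∣x-a∣ : ∀ x a K → ∣ a ∣ ℕ.+ K ℕ.< ∣ x ∣ → K ℕ.< ∣ x - a ∣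
∣a∣+K<∣x∣⇒K<∣x-a∣ x a K lt = ℕ.+-cancelˡ-< (∣ a ∣) K (∣ x - a ∣) (ℕ.<-≤-trans lt (begin
  ∣ x ∣                 ≡⟨ cong ∣_∣ (sym (sub-add x a)) ⟩
  ∣ (x - a) + a ∣       ≤⟨ ℤ.∣i+j∣≤∣i∣+∣j∣ (x - a) a ⟩
  ∣ x - a ∣ ℕ.+ ∣ a ∣   ≡⟨ ℕ.+-comm (∣ x - a ∣) (∣ a ∣) ⟩
  ∣ a ∣ ℕ.+ ∣ x - a ∣   ∎))
  where
  open ℕ.≤-Reasoning
  sub-add : ∀ x a → (x - a) + a ≡ x
  sub-add = solve 2 (λ x a → (x :- a) :+ a := x) refl

module _ (em : ExcludedMiddle 0ℓ) {U : Subset} (U-infinite : Infinite U) where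

  Infinite⇒unbounded : ∀ M → Σ (El U) λ x → M ℕ.< ∣ proj₁ x ∣
  Infinite⇒unbounded M with em {Σ (El U) λ x → M ℕ.< ∣ proj₁ x ∣}
  ... | yes far = far
  ... | no ¬far = ⊥-elim (U-infinite (ball M , λ x x∈U →
    ∈-ball M x (ℕ.≮⇒≥ λ M<∣x∣ → ¬far ((x , x∈U) , M<∣x∣))))

  Infinite⇒inhabited : El U
  Infinite⇒inhabited = proj₁ (Infinite⇒unbounded 0)

  Infinite⇒far-from : ∀ a K b L →
                      Σ (El U) λ x → K ℕ.< ∣ proj₁ x - a ∣ × L ℕ.< ∣ proj₁ x - b ∣
  Infinite⇒far-from a K b L with Infinite⇒unbounded ((∣ a ∣ ℕ.+ K) ℕ.+ (∣ b ∣ ℕ.+ L))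
  ... | x , big = x ,
    ∣a∣+K<∣x∣⇒K<∣x-a∣ (proj₁ x) a K (ℕ.≤-<-trans (ℕ.m≤m+n _ _) big) ,
    ∣a∣+K<∣x∣⇒K<∣x-a∣ (proj₁ x) b L (ℕ.≤-<-trans (ℕ.m≤n+m _ (∣ a ∣ ℕ.+ K)) big)

  LIP-bounded⇒constant : ∀ {f : Fun U} → IsLIP U f → ∀ B → (∀ y → ∣ f y ∣ ℕ.≤ B) →
                         ∀ a y → f y ≡ f a
  LIP-bounded⇒constant {f} f-lip B bounded a y
    with Infinite⇒far-from (proj₁ a) (B ℕ.+ B) (proj₁ y) (B ℕ.+ B)
  ... | x , far-from-a , far-from-y =
    trans (sym (agrees-far y far-from-y)) (agrees-far a far-from-a)
    where
    agrees-far : ∀ z → B ℕ.+ B ℕ.< ∣ proj₁ x - proj₁ z ∣ → f x ≡ f z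
    agrees-far z far = LIP-rigid f-lip x z (ℕ.≤-<-trans (begin
      ∣ f x - f z ∣         ≤⟨ ℤ.∣i-j∣≤∣i∣+∣j∣ (f x) (f z) ⟩
      ∣ f x ∣ ℕ.+ ∣ f z ∣   ≤⟨ ℕ.+-mono-≤ (bounded x) (bounded z) ⟩
      B ℕ.+ B               ∎) far)
      where open ℕ.≤-Reasoning

≈zeroF⊎nonvanishing : ExcludedMiddle 0ℓ → ∀ {U} (f : Fun U) →
                      f ≈ zeroF ⊎ Σ (El U) λ a → f a ≢ 0ℤ
≈zeroF⊎nonvanishing em f with em {Σ _ λ a → f a ≢ 0ℤ}
... | yes nonvanishing = inj₂ nonvanishing
... | no ¬nonvanishing = inj₁ λ y →
  decidable-stable (f y ℤ.≟ 0ℤ) λ fy≢0 → ¬nonvanishing (y , fy≢0)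

LIP-integralDomain : ExcludedMiddle 0ℓ → ∀ {U} → Infinite U → IsIntegralDomainLIP U
LIP-integralDomain em {U} U-infinite = 1≉0 , noZeroDivisors
  where
  1≉0 : ¬ (oneF {U} ≈ zeroF)
  1≉0 1≈0 with 1≈0 (Infinite⇒inhabited em U-infinite)
  ... | ()

  noZeroDivisors : ∀ (f g : Fun U) → IsLIP U f → IsLIP U g →
                   (f · g) ≈ zeroF → (f ≈ zeroF) ⊎ (g ≈ zeroF)
  noZeroDivisors f g f-lip g-lip fg≈0
    with ≈zeroF⊎nonvanishing em f | ≈zeroF⊎nonvanishing em g
  ... | inj₁ f≈0 | _        = inj₁ f≈0
  ... | inj₂ _   | inj₁ g≈0 = inj₂ g≈0
  ... | inj₂ (a , fa≢0) | inj₂ (b , gb≢0)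
    with Infinite⇒far-from em U-infinite (proj₁ a) (∣ f a ∣) (proj₁ b) (∣ g b ∣)
  ... | x , far-from-a , far-from-b = ⊥-elim
    ([ LIP-nonvanishing f-lip x a fa≢0 far-from-a , LIP-nonvanishing g-lip x b gb≢0 far-from-b ]′
     (ℤ.i*j≡0⇒i≡0∨j≡0 (f x) (fg≈0 x)))

const-isLIP : ∀ {U} c → IsLIP U (const c)
const-isLIP c X = (c ∷ []) , λ y _ → trans (cong (_+_ c) (ℤ.*-zeroʳ (proj₁ y))) (ℤ.+-identityʳ c)

∣i∣≡1⇒i≡±1 : ∀ i → ∣ i ∣ ≡ 1 → i ≡ 1ℤ ⊎ i ≡ -1ℤ
∣i∣≡1⇒i≡±1 (+ .1)       refl = inj₁ refl
∣i∣≡1⇒i≡±1 -[1+ zero ]  refl = inj₂ refl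

IsUnit⇒∣∣≡1 : ∀ {U} (f : Fun U) → IsUnit U f → ∀ y → ∣ f y ∣ ≡ 1
IsUnit⇒∣∣≡1 f (g , _ , fg≈1) y =
  ℕ.m*n≡1⇒m≡1 (∣ f y ∣) (∣ g y ∣) (trans (sym (ℤ.abs-* (f y) (g y))) (cong ∣_∣ (fg≈1 y)))

LIP-units : ExcludedMiddle 0ℓ → ∀ {U} → Infinite U → UnitsArePlusMinusOne U
LIP-units em {U} U-infinite f f-lip = unit⇒±1 , ±1⇒unit
  where
  unit⇒±1 : IsUnit U f → (f ≈ oneF) ⊎ (f ≈ minusOneF)
  unit⇒±1 f-unit = map (λ fa≡1 y → trans (f-constant y) fa≡1)
                       (λ fa≡-1 y → trans (f-constant y) fa≡-1)
                       (∣i∣≡1⇒i≡±1 (f a) (IsUnit⇒∣∣≡1 f f-unit a))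
    where
    a : El U
    a = Infinite⇒inhabited em U-infinite
    f-constant : ∀ y → f y ≡ f a
    f-constant = LIP-bounded⇒constant em U-infinite f-lip 1 (ℕ.≤-reflexive ∘ IsUnit⇒∣∣≡1 f f-unit) a

  ±1⇒unit : (f ≈ oneF) ⊎ (f ≈ minusOneF) → IsUnit U f
  ±1⇒unit (inj₁ f≈1)  = oneF , const-isLIP 1ℤ , λ y → cong (_* 1ℤ) (f≈1 y)
  ±1⇒unit (inj₂ f≈-1) = minusOneF , const-isLIP -1ℤ , λ y → cong (_* -1ℤ) (f≈-1 y)

lemma4 : ExcludedMiddle 0ℓ → (U : Subset) → Infinite U →
    IsIntegralDomainLIP U × UnitsArePlusMinusOne U
lemma4 em U U-infinite = LIP-integralDomain em U-infinite , LIP-units em U-infinite
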